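{- Let $n$ be a positive integer and $\pi$ a $(3,n)$-parking function with $\mathrm{pides}(\pi)=2^a1^b$ (so $n=2a+b$). Then $\mathbb{S}(\pi)$ is a $(3,a+2b)$-parking function; that is, the lattice path from $(0,0)$ to $(3,a+2b)$ whose number of north steps in column $x$ equals the number of cars $\mathbb{S}(\pi)$ places in column $x$ ($x=\ell,c,r$) stays weakly above the line $y=\frac{a+2b}{3}x$.
   Context: A $(3,n)$-parking function $\pi$ is a north/east lattice path from $(0,0)$ to $(3,n)$ weakly above $y=\frac n3x$ whose $n$ north steps are labeled bijectively by $1,\dots,n$ (cars, in the cells just right of the north steps), increasing upward in each column. With $d=\gcd(3,n)$, the cell with lower-left corner $(x,y)$ has rank $3y-nx+\lfloor xd/3\rfloor$; a car's rank is that of its cell. $\mathrm{ides}(\pi)=\{i:\mathrm{rank}(i)<\mathrm{rank}(i+1)\}=\{i_1<\dots<i_r\}$, $\mathrm{pides}(\pi)=(i_1,i_2-i_1,\dots,n-i_r)$; $2^a1^b$ is the composition with $a$ parts $2$ followed by $b$ parts $1$. The three columns are called $\ell,c,r$ (left to right). If $\mathrm{pides}(\pi)=2^a1^b$, then for $i=1,\dots,a$ the cars $2i-1,2i$ ("pair $i$") lie in two distinct columns, and its placement type is $L$ if these columns are $\{\ell,c\}$, $R$ if $\{c,r\}$, $C$ if $\{\ell,r\}$; the singleton car $2a+s$ ($s=1,\dots,b$) has type $L$, $C$, $R$ if it lies in column $\ell$, $c$, $r$ respectively. Let $p_1,\dots,p_a$ be the types of pairs $1,\dots,a$ and $p_{a+1},\dots,p_{a+b}$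 the types of singletons $2a+1,\dots,2a+b$. The switch map: consider the $b$ pairs $(2i-1,2i)$, $i=1,\dots,b$, and the $a$ singletons $2b+1,\dots,2b+a$, listed as objects $1,\dots,a+b$ (pairs first); give object $j$ the type $p_{a+b+1-j}$; a pair of type $L$/$R$/$C$ puts one car in each of the columns $\{\ell,c\}$/$\{c,r\}$/$\{\ell,r\}$, a singleton of type $L$/$C$/$R$ goes to column $\ell$/$c$/$r$. $\mathbb{S}(\pi)$ is the resulting labeling of the $3\times(a+2b)$ grid, with the cars in each column stacked in increasing order upward and the column heights equal to the number of cars assigned to each column. -}

module Defs where

open import Data.Nat using (ℕ; zero; suc; _+_; _*_; _∸_; _≤_; _<_; _≤?_; _<?_)
open import Data.Nat.DivMod using (_/_; _%_)
open import Data.Nat.GCD using (gcd)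
open import Data.Fin using (Fin; toℕ; fromℕ<) renaming (_≟_ to _≟ᶠ_)
open import Data.Integer as ℤ using (ℤ; +_)
import Data.Integer.Properties as ℤP
open import Data.List using (List; []; _∷_; _++_; filter; length; map; upTo; allFin)
open import Data.Product using (_×_; _,_)
open import Relation.Nullary using (yes; no)

pattern colℓ = Fin.zero
pattern colc = Fin.suc Fin.zero
pattern colr = Fin.suc (Fin.suc Fin.zero)

-- A labeling of a 3 x m grid: car k (1-based, k = 1..m) is the Fin index k-1,
-- and f (k-1) is the column of car k.  Within a column the cars are stacked
-- increasingly upward, and the column heights are the numbers of cars in the
-- columns, so such a function determines the labeled path.
Labeling : ℕ → Set
Labeling m = Fin m → Fin 3

count : ∀ {m} → Labeling m → Fin 3 → ℕ
count {m} f x = length (filter (λ i → f i ≟ᶠ x) (allFin m))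

-- The path from (0,0) to (3,m) with these column heights stays weakly above
-- y = (m/3) x: the lowest point of the path on x = 1 is (1, h_ℓ) and on x = 2
-- is (2, h_ℓ + h_c).
IsPF : (m : ℕ) → Labeling m → Set
IsPF m f = (m ≤ 3 * count f colℓ) × (2 * m ≤ 3 * (count f colℓ + count f colc))

record PF (n : ℕ) : Set where
  constructor mkPF
  field
    col  : Labeling n
    isPF : IsPF n col
open PF public

-- column of car k (1-based); out-of-range cars get a dummy value (never used)
colOf : ∀ {m} → Labeling m → ℕ → Fin 3
colOf {m} f k with (k ∸ 1) <? m
... | yes p = f (fromℕ< p)
... | no _  = colℓ

base : ∀ {m} → Labeling m → Fin 3 → ℕ
base f colℓ = 0
base f colc = count f colℓ
base f colr = count f colℓ + count f colc

rowOf : ∀ {m} → Labeling m → ℕ → ℕ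
rowOf f k = base f (colOf f k)
  + length (filter (λ j → colOf f j ≟ᶠ colOf f k) (map suc (upTo (k ∸ 1))))

rank : ∀ {n} → PF n → ℕ → ℤ
rank {n} π k =
  let f = col π ; x = toℕ (colOf f k) ; d = gcd 3 n in
  ((+ (3 * rowOf f k)) ℤ.- (+ (n * x))) ℤ.+ (+ ((x * d) / 3))

ides : ∀ {n} → PF n → List ℕ
ides {n} π = filter (λ i → rank π i ℤP.<? rank π (suc i)) (map suc (upTo (n ∸ 1)))

diffs : List ℕ → List ℕ
diffs (x ∷ y ∷ rest) = (y ∸ x) ∷ diffs (y ∷ rest)
diffs _ = []

pides : ∀ {n} → PF n → List ℕ
pides {n} π = diffs (0 ∷ (ides π ++ (n ∷ [])))

replicate : ℕ → ℕ → List ℕ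
replicate zero x = []
replicate (suc k) x = x ∷ replicate k x

twoOne : ℕ → ℕ → List ℕ
twoOne a b = replicate a 2 ++ replicate b 1

data PType : Set where
  L C R : PType

-- type of a pair occupying columns x, y
-- (if x = y, which the paper shows cannot happen, we return L arbitrarily)
pairType : Fin 3 → Fin 3 → PType
pairType colℓ colc = L
pairType colc colℓ = L
pairType colc colr = R
pairType colr colc = R
pairType colℓ colr = C
pairType colr colℓ = C
pairType _ _ = L

singleType : Fin 3 → PType
singleType colℓ = L
singleType colc = C
singleType colr = R

ptype : ∀ {n} → PF n → (a : ℕ) → ℕ → PType
ptype π a j with j ≤? a
... | yes _ = pairType (colOf (col π) (2 * j ∸ 1)) (colOf (col π) (2 * j))
... | no _  = singleType (colOf (col π) (a + j))   -- singleton car 2a + (j - a)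

-- columns of a pair of given type: (column of car 2i-1, column of car 2i).
-- Which car of the pair goes in which column is not specified in the paper;
-- we put the smaller car in the left column (irrelevant for the column heights).
pairCols : PType → Fin 3 × Fin 3
pairCols L = colℓ , colc
pairCols R = colc , colr
pairCols C = colℓ , colr

singleCol : PType → Fin 3
singleCol L = colℓ
singleCol C = colc
singleCol R = colr

switchColℕ : ∀ {n} → PF n → (a b : ℕ) → ℕ → Fin 3
switchColℕ π a b m with m ≤? 2 * b
... | yes _ = pick (pairCols (ptype π a (a + b + 1 ∸ j))) (m % 2)
  where
    j = (m + 1) / 2
    pick : Fin 3 × Fin 3 → ℕ → Fin 3
    pick (x , y) 1 = x
    pick (x , y) _ = y
... | no _  = singleCol (ptype π a (a + b + 1 ∸ (m ∸ b)))

switch : ∀ {n} → PF n → (a b : ℕ) → Labeling (a + 2 * b)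
switch π a b i = switchColℕ π a b (suc (toℕ i))

-- Only the heights hℓ and hℓ + hc of the columns ℓ and c matter.  Two consecutive cars
-- in one column have increasing ranks, so a car i outside ides lies in another column
-- than car i + 1; as pides π = 2^a 1^b leaves exactly the odd i < 2a outside ides, each
-- pair of π occupies two columns, and n = 2a + b.  An object of type t then contributes
-- to hℓ + hc, as a pair, one car more than it contributes to hℓ as a singleton, and as a
-- singleton exactly what it contributes to hℓ as a pair.  𝕊 turns the a pairs into
-- singletons and the b singletons into pairs (the reversed order does not affect
-- heights), so hℓ(π) + hc(π) = hℓ(𝕊π) + a and hℓ(𝕊π) + hc(𝕊π) = hℓ(π) + b, which turns
-- the two parking inequalities of π into those of 𝕊(π).

module Submission where

open import Defs
open import Data.Nat using (ℕ; zero; suc; _+_; _*_; _∸_; _≤_; _<_; s≤s; z<s; _≤?_; _<?_)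
open import Data.Nat.Properties
open import Data.Nat.DivMod using (_/_; _%_; m*n/n≡m; m*n%n≡0; [m+kn]%n≡m%n; +-distrib-/-∣ˡ)
open import Data.Nat.Divisibility using (n∣m*n)
open import Data.Nat.GCD using (gcd)
open import Data.Nat.ListAction using (sum)
open import Data.Nat.ListAction.Properties using (sum-++)
open import Data.Nat.Tactic.RingSolver using (solve-∀)
open import Algebra.Properties.CommutativeSemigroup +-commutativeSemigroup using (interchange)
open import Data.Bool using (if_then_else_)
open import Data.Fin using (Fin; toℕ) renaming (_≟_ to _≟ᶠ_)
open import Data.Fin.Properties using (fromℕ<-toℕ; toℕ<n)
open import Data.Integer as ℤ using (ℤ; +<+)
import Data.Integer.Properties as ℤP
open import Data.List using ([]; _∷_; _++_; filter; length; map; upTo; tabulate)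
open import Data.List.Properties using (∷-injective; upTo-∷ʳ; map-++; filter-++; length-++)
open import Data.List.Relation.Unary.All as All using (All; []; _∷_)
import Data.List.Relation.Unary.All.Properties as AllP
open import Data.List.Relation.Unary.Any using (here; there)
open import Data.List.Membership.Propositional using (_∈_; _∉_)
open import Data.List.Membership.Propositional.Properties using (∈-filter⁺; ∈-map⁺; ∈-upTo⁺)
open import Data.Product using (_×_; _,_; proj₁; proj₂)
open import Data.Empty using (⊥-elim)
open import Function using (id; _∘_)
open import Relation.Nullary using (yes; no; does)
open import Relation.Binary.PropositionalEquality
open ≡-Reasoning

-- Finite sums over 1, …, k

∑₁ : (ℕ → ℕ) → ℕ → ℕ
∑₁ F zero    = 0
∑₁ F (suc k) = ∑₁ F k + F (suc k)

∑₁-cong : ∀ {F G} k → (∀ j → j < k → F (suc j) ≡ G (suc j)) → ∑₁ F k ≡ ∑₁ G k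
∑₁-cong zero    F≡G = refl
∑₁-cong (suc k) F≡G =
  cong₂ _+_ (∑₁-cong k (λ j j<k → F≡G j (m<n⇒m<1+n j<k))) (F≡G k (n<1+n k))

∑₁-head : ∀ F k → ∑₁ F (suc k) ≡ F 1 + ∑₁ (F ∘ suc) k
∑₁-head F zero    = +-comm 0 (F 1)
∑₁-head F (suc k) = trans (cong (_+ F (suc (suc k))) (∑₁-head F k)) (+-assoc (F 1) _ _)

∑₁-+ : ∀ F k l → ∑₁ F (k + l) ≡ ∑₁ F k + ∑₁ (λ j → F (k + j)) l
∑₁-+ F k zero    = trans (cong (∑₁ F) (+-identityʳ k)) (sym (+-identityʳ _))
∑₁-+ F k (suc l) = begin
  ∑₁ F (k + suc l)                    ≡⟨ cong (∑₁ F) (+-suc k l) ⟩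
  ∑₁ F (k + l) + F (suc (k + l))      ≡⟨ cong (_+ F (suc (k + l))) (∑₁-+ F k l) ⟩
  ∑₁ F k + G l + F (suc (k + l))      ≡⟨ +-assoc (∑₁ F k) (G l) _ ⟩
  ∑₁ F k + (G l + F (suc (k + l)))    ≡⟨ cong (λ m → ∑₁ F k + (G l + F m)) (+-suc k l) ⟨
  ∑₁ F k + G (suc l)                  ∎
  where
  G : ℕ → ℕ
  G = ∑₁ (λ j → F (k + j))

∑₁-distrib : ∀ F G k → ∑₁ (λ j → F j + G j) k ≡ ∑₁ F k + ∑₁ G k
∑₁-distrib F G zero    = refl
∑₁-distrib F G (suc k) =
  trans (cong (_+ (F (suc k) + G (suc k))) (∑₁-distrib F G k))
        (interchange (∑₁ F k) (∑₁ G k) (F (suc k)) (G (suc k)))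

∑₁-const : ∀ c k → ∑₁ (λ _ → c) k ≡ k * c
∑₁-const c zero    = refl
∑₁-const c (suc k) = trans (cong (_+ c) (∑₁-const c k)) (+-comm (k * c) c)

∑₁-pairs : ∀ F k → ∑₁ F (2 * k) ≡ ∑₁ (λ i → F (2 * i ∸ 1) + F (2 * i)) k
∑₁-pairs F zero    = refl
∑₁-pairs F (suc k) = begin
  ∑₁ F (2 * suc k)                                  ≡⟨ cong (∑₁ F) (*-suc 2 k) ⟩
  ∑₁ F (2 * k) + F (suc (2 * k)) + F (suc (suc (2 * k)))
    ≡⟨ cong (λ s → s + F (suc (2 * k)) + F (suc (suc (2 * k)))) (∑₁-pairs F k) ⟩
  P k + F (suc (2 * k)) + F (suc (suc (2 * k)))     ≡⟨ +-assoc (P k) _ _ ⟩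
  P k + (F (suc (2 * k)) + F (suc (suc (2 * k))))   ≡⟨ cong (λ m → P k + (F (m ∸ 1) + F m)) (*-suc 2 k) ⟨
  P (suc k)                                         ∎
  where
  P : ℕ → ℕ
  P = ∑₁ (λ i → F (2 * i ∸ 1) + F (2 * i))

∑₁-reverse : ∀ F k → ∑₁ (λ j → F (suc k ∸ j)) k ≡ ∑₁ F k
∑₁-reverse F zero    = refl
∑₁-reverse F (suc k) = begin
  ∑₁ (λ j → F (suc (suc k) ∸ j)) k + F (suc k ∸ k)
    ≡⟨ cong₂ _+_ (∑₁-cong k (λ j j<k → cong F (+-∸-assoc 1 (m<n⇒m<1+n j<k)))) (cong F (m+n∸n≡m 1 k)) ⟩
  ∑₁ (λ j → F (suc (suc k ∸ j))) k + F 1   ≡⟨ cong (_+ F 1) (∑₁-reverse (F ∘ suc) k) ⟩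
  ∑₁ (F ∘ suc) k + F 1                     ≡⟨ +-comm _ (F 1) ⟩
  F 1 + ∑₁ (F ∘ suc) k                     ≡⟨ ∑₁-head F k ⟨
  ∑₁ F (suc k)                             ∎

-- Column counts as sums of indicators

δ : Fin 3 → Fin 3 → ℕ
δ u x = if does (u ≟ᶠ x) then 1 else 0

length-filter-∷ : ∀ {m} (f : Labeling m) x i is →
  length (filter (λ j → f j ≟ᶠ x) (i ∷ is)) ≡ δ (f i) x + length (filter (λ j → f j ≟ᶠ x) is)
length-filter-∷ f x i is with f i ≟ᶠ x
... | yes _ = refl
... | no _  = refl

length-filter-tabulate : ∀ {k m} (t : Fin k → Fin m) (f : Labeling m) (g : ℕ → Fin 3) x →
  (∀ i → f (t i) ≡ g (suc (toℕ i))) →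
  length (filter (λ j → f j ≟ᶠ x) (tabulate t)) ≡ ∑₁ (λ j → δ (g j) x) k
length-filter-tabulate {zero}  t f g x f∘t≡g = refl
length-filter-tabulate {suc k} t f g x f∘t≡g = begin
  length (filter (λ j → f j ≟ᶠ x) (tabulate t))
    ≡⟨ length-filter-∷ f x (t Fin.zero) (tabulate (t ∘ Fin.suc)) ⟩
  δ (f (t Fin.zero)) x + length (filter (λ j → f j ≟ᶠ x) (tabulate (t ∘ Fin.suc)))
    ≡⟨ cong₂ _+_ (cong (λ u → δ u x) (f∘t≡g Fin.zero))
                 (length-filter-tabulate (t ∘ Fin.suc) f (g ∘ suc) x (f∘t≡g ∘ Fin.suc)) ⟩
  δ (g 1) x + ∑₁ (λ j → δ (g (suc j)) x) k
    ≡⟨ ∑₁-head (λ j → δ (g j) x) k ⟨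
  ∑₁ (λ j → δ (g j) x) (suc k) ∎

colOf-toℕ : ∀ {m} (f : Labeling m) i → f i ≡ colOf f (suc (toℕ i))
colOf-toℕ {m} f i with toℕ i <? m
... | yes i<m = cong f (sym (fromℕ<-toℕ i i<m))
... | no  i≮m = ⊥-elim (i≮m (toℕ<n i))

count≡∑₁ : ∀ {m} (f : Labeling m) x → count f x ≡ ∑₁ (λ k → δ (colOf f k) x) m
count≡∑₁ f x = length-filter-tabulate id f (colOf f) x (colOf-toℕ f)

count-switch≡∑₁ : ∀ {n} (π : PF n) a b x →
  count (switch π a b) x ≡ ∑₁ (λ k → δ (switchColℕ π a b k) x) (a + 2 * b)
count-switch≡∑₁ π a b x = length-filter-tabulate id (switch π a b) (switchColℕ π a b) x (λ _ → refl)

-- Ranks and the descent set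

length-filter-upTo-suc : ∀ (g : ℕ → Fin 3) q → g (suc q) ≡ g (suc (suc q)) →
  length (filter (λ j → g j ≟ᶠ g (suc (suc q))) (map suc (upTo (suc q))))
    ≡ suc (length (filter (λ j → g j ≟ᶠ g (suc (suc q))) (map suc (upTo q))))
length-filter-upTo-suc g q same = begin
  length (filter P (map suc (upTo (suc q))))
    ≡⟨ cong (λ xs → length (filter P (map suc xs))) (upTo-∷ʳ q) ⟨
  length (filter P (map suc (upTo q ++ q ∷ [])))
    ≡⟨ cong (λ xs → length (filter P xs)) (map-++ suc (upTo q) (q ∷ [])) ⟩
  length (filter P (map suc (upTo q) ++ suc q ∷ []))
    ≡⟨ cong length (filter-++ P (map suc (upTo q)) (suc q ∷ [])) ⟩
  length (filter P (map suc (upTo q)) ++ filter P (suc q ∷ []))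
    ≡⟨ length-++ (filter P (map suc (upTo q))) ⟩
  length (filter P (map suc (upTo q))) + length (filter P (suc q ∷ []))
    ≡⟨ cong₂ _+_ refl last ⟩
  length (filter P (map suc (upTo q))) + 1
    ≡⟨ +-comm _ 1 ⟩
  suc (length (filter P (map suc (upTo q)))) ∎
  where
  P = λ j → g j ≟ᶠ g (suc (suc q))
  last : length (filter P (suc q ∷ [])) ≡ 1
  last with g (suc q) ≟ᶠ g (suc (suc q))
  ... | yes _  = refl
  ... | no neq = ⊥-elim (neq same)

rowOf-sameCol : ∀ {m} (f : Labeling m) k → colOf f (suc k) ≡ colOf f (suc (suc k)) →
  rowOf f (suc (suc k)) ≡ suc (rowOf f (suc k))
rowOf-sameCol f k same rewrite same =
  trans (cong₂ _+_ refl (length-filter-upTo-suc (colOf f) k same)) (+-suc _ _)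

cellRank : ℕ → ℕ → Fin 3 → ℤ
cellRank n y x = ((ℤ.+ (3 * y)) ℤ.- (ℤ.+ (n * toℕ x))) ℤ.+ (ℤ.+ ((toℕ x * gcd 3 n) / 3))

cellRank-suc : ∀ n y x → cellRank n y x ℤ.< cellRank n (suc y) x
cellRank-suc n y x = ℤP.+-monoˡ-< (ℤ.+ ((toℕ x * gcd 3 n) / 3))
  (ℤP.+-monoˡ-< (ℤ.- (ℤ.+ (n * toℕ x))) (+<+ (*-monoʳ-< 3 (n<1+n y))))

rank-sameCol : ∀ {n} (π : PF n) k → colOf (col π) (suc k) ≡ colOf (col π) (suc (suc k)) →
  rank π (suc k) ℤ.< rank π (suc (suc k))
rank-sameCol {n} π k same =
  subst₂ (λ y x → rank π (suc k) ℤ.< cellRank n y x)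
         (sym (rowOf-sameCol (col π) k same)) same
         (cellRank-suc n (rowOf (col π) (suc k)) (colOf (col π) (suc k)))

sameCol⇒∈ides : ∀ {n} (π : PF n) k → suc k < n →
  colOf (col π) (suc k) ≡ colOf (col π) (suc (suc k)) → suc k ∈ ides π
sameCol⇒∈ides π k (s≤s k<n) same =
  ∈-filter⁺ (λ i → rank π i ℤP.<? rank π (suc i)) (∈-map⁺ suc (∈-upTo⁺ k<n)) (rank-sameCol π k same)

-- Compositions read off a descent set

0<∸⇒< : ∀ {x y} → 0 < y ∸ x → x < y
0<∸⇒< {x} {y} 0<y∸x = m∸n≢0⇒n<m (λ y∸x≡0 → <-irrefl (sym y∸x≡0) 0<y∸x)

∸≡suc⇒≡+ : ∀ {x y d} → y ∸ x ≡ suc d → y ≡ x + suc d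
∸≡suc⇒≡+ {zero}          refl = refl
∸≡suc⇒≡+ {suc x} {zero}  ()
∸≡suc⇒≡+ {suc x} {suc y} eq   = cong suc (∸≡suc⇒≡+ {x} {y} eq)

diffs-telescope : ∀ x ys n ps → All (0 <_) ps → diffs (x ∷ ys ++ n ∷ []) ≡ ps →
  n ≡ x + sum ps × All (x <_) ys
diffs-telescope x []       n _ (0<n∸x ∷ []) refl =
  sym (trans (cong (x +_) (+-identityʳ (n ∸ x))) (m+[n∸m]≡n {x} (<⇒≤ (0<∸⇒< 0<n∸x)))) , []
diffs-telescope x (y ∷ ys) n _ (0<y∸x ∷ 0<ps) refl
  with diffs-telescope y ys n _ 0<ps refl
... | n≡y+Σ , y<ys = n≡x+Σ , x<y ∷ All.map (<-trans x<y) y<ys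
  where
  x<y = 0<∸⇒< 0<y∸x
  Σ = sum (diffs (y ∷ ys ++ n ∷ []))
  n≡x+Σ : n ≡ x + (y ∸ x + Σ)
  n≡x+Σ = begin
    n               ≡⟨ n≡y+Σ ⟩
    y + Σ           ≡⟨ cong (_+ Σ) (m+[n∸m]≡n {x} (<⇒≤ x<y)) ⟨
    x + (y ∸ x) + Σ ≡⟨ +-assoc x (y ∸ x) Σ ⟩
    x + (y ∸ x + Σ) ∎

All-replicate : ∀ {P : ℕ → Set} k {m} → P m → All P (replicate k m)
All-replicate zero    Pm = []
All-replicate (suc k) Pm = Pm ∷ All-replicate k Pm

diffs-pairs-odd∉ : ∀ x ys n a qs → All (0 <_) qs → diffs (x ∷ ys ++ n ∷ []) ≡ replicate a 2 ++ qs →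
  ∀ i → i < a → x + suc (2 * i) ∉ ys
diffs-pairs-odd∉ x [] n a qs 0<qs eq i i<a ()
diffs-pairs-odd∉ x (y ∷ ys) n (suc a) qs 0<qs eq i i<a
  with ∸≡suc⇒≡+ {x} {y} (proj₁ (∷-injective eq))
... | refl = odd∉ i i<a
  where
  rest = proj₂ (∷-injective eq)
  x+2<ys : All (x + 2 <_) ys
  x+2<ys = proj₂ (diffs-telescope (x + 2) ys n _ (AllP.++⁺ (All-replicate a z<s) 0<qs) rest)
  shift : ∀ x i → x + suc (2 * suc i) ≡ x + 2 + suc (2 * i)
  shift = solve-∀
  x+1<x+2 : x + 1 < x + 2
  x+1<x+2 = +-monoʳ-< x (n<1+n 1)
  odd∉ : ∀ i → i < suc a → x + suc (2 * i) ∉ x + 2 ∷ ys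
  odd∉ zero    _         (here  x+1≡x+2) = <-irrefl x+1≡x+2 x+1<x+2
  odd∉ zero    _         (there x+1∈ys)  = <-asym (All.lookup x+2<ys x+1∈ys) x+1<x+2
  odd∉ (suc i) _         (here  eq')     =
    <-irrefl (sym (trans (sym (shift x i)) eq')) (m<m+n (x + 2) z<s)
  odd∉ (suc i) (s≤s i<a) (there odd∈ys)  =
    diffs-pairs-odd∉ (x + 2) ys n a qs 0<qs rest i i<a (subst (_∈ ys) (shift x i) odd∈ys)

sum-replicate : ∀ k m → sum (replicate k m) ≡ k * m
sum-replicate zero    m = refl
sum-replicate (suc k) m = cong (m +_) (sum-replicate k m)

sum-twoOne : ∀ a b → sum (twoOne a b) ≡ 2 * a + b
sum-twoOne a b = begin
  sum (replicate a 2 ++ replicate b 1)         ≡⟨ sum-++ (replicate a 2) (replicate b 1) ⟩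
  sum (replicate a 2) + sum (replicate b 1)    ≡⟨ cong₂ _+_ (sum-replicate a 2) (sum-replicate b 1) ⟩
  a * 2 + b * 1                                ≡⟨ cong₂ _+_ (*-comm a 2) (*-identityʳ b) ⟩
  2 * a + b                                    ∎

twoOne-positive : ∀ a b → All (0 <_) (twoOne a b)
twoOne-positive a b = AllP.++⁺ (All-replicate a z<s) (All-replicate b z<s)

pides-twoOne⇒size : ∀ {n} (π : PF n) a b → pides π ≡ twoOne a b → n ≡ 2 * a + b
pides-twoOne⇒size π a b eq =
  trans (proj₁ (diffs-telescope 0 (ides π) _ _ (twoOne-positive a b) eq)) (sum-twoOne a b)

2[1+j]∸1≡2j+1 : ∀ j → 2 * suc j ∸ 1 ≡ suc (2 * j)
2[1+j]∸1≡2j+1 j = cong (_∸ 1) (*-suc 2 j)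

pides-twoOne⇒pairs-split : ∀ {n} (π : PF n) a b → pides π ≡ twoOne a b →
  ∀ i → i < a → colOf (col π) (2 * suc i ∸ 1) ≢ colOf (col π) (2 * suc i)
pides-twoOne⇒pairs-split {n} π a b eq i i<a same =
  diffs-pairs-odd∉ 0 (ides π) n a (replicate b 1) (All-replicate b z<s) eq i i<a
    (sameCol⇒∈ides π (2 * i) 2i+1<n (subst₂ (λ u v → colOf (col π) u ≡ colOf (col π) v) odd even same))
  where
  even = *-suc 2 i
  odd = 2[1+j]∸1≡2j+1 i
  2i+1<n : suc (2 * i) < n
  2i+1<n = subst (suc (2 * i) <_) (sym (pides-twoOne⇒size π a b eq))
    (≤-trans (subst (_≤ 2 * a) even (*-monoʳ-≤ 2 i<a)) (m≤m+n (2 * a) b))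

-- Placement types

pairIn : PType → Fin 3 → ℕ
pairIn t x = δ (proj₁ (pairCols t)) x + δ (proj₂ (pairCols t)) x

singleIn : PType → Fin 3 → ℕ
singleIn t x = δ (singleCol t) x

pairType-pairIn : ∀ u v x → u ≢ v → δ u x + δ v x ≡ pairIn (pairType u v) x
pairType-pairIn colℓ colℓ x u≢v = ⊥-elim (u≢v refl)
pairType-pairIn colℓ colc x u≢v = refl
pairType-pairIn colℓ colr x u≢v = refl
pairType-pairIn colc colℓ x u≢v = +-comm (δ colc x) _
pairType-pairIn colc colc x u≢v = ⊥-elim (u≢v refl)
pairType-pairIn colc colr x u≢v = refl
pairType-pairIn colr colℓ x u≢v = +-comm (δ colr x) _
pairType-pairIn colr colc x u≢v = +-comm (δ colr x) _
pairType-pairIn colr colr x u≢v = ⊥-elim (u≢v refl)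

singleType-singleIn : ∀ u x → δ u x ≡ singleIn (singleType u) x
singleType-singleIn colℓ x = refl
singleType-singleIn colc x = refl
singleType-singleIn colr x = refl

pairIn-ℓc : ∀ t → pairIn t colℓ + pairIn t colc ≡ singleIn t colℓ + 1
pairIn-ℓc L = refl
pairIn-ℓc C = refl
pairIn-ℓc R = refl

singleIn-ℓc : ∀ t → singleIn t colℓ + singleIn t colc ≡ pairIn t colℓ
singleIn-ℓc L = refl
singleIn-ℓc C = refl
singleIn-ℓc R = refl

∑₁-pairIn-ℓc : ∀ (T : ℕ → PType) k →
  ∑₁ (λ i → pairIn (T i) colℓ) k + ∑₁ (λ i → pairIn (T i) colc) k ≡ ∑₁ (λ i → singleIn (T i) colℓ) k + k
∑₁-pairIn-ℓc T k = begin
  ∑₁ (λ i → pairIn (T i) colℓ) k + ∑₁ (λ i → pairIn (T i) colc) k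
    ≡⟨ ∑₁-distrib (λ i → pairIn (T i) colℓ) (λ i → pairIn (T i) colc) k ⟨
  ∑₁ (λ i → pairIn (T i) colℓ + pairIn (T i) colc) k
    ≡⟨ ∑₁-cong k (λ i _ → pairIn-ℓc (T (suc i))) ⟩
  ∑₁ (λ i → singleIn (T i) colℓ + 1) k
    ≡⟨ ∑₁-distrib (λ i → singleIn (T i) colℓ) (λ _ → 1) k ⟩
  ∑₁ (λ i → singleIn (T i) colℓ) k + ∑₁ (λ _ → 1) k
    ≡⟨ cong₂ _+_ refl (trans (∑₁-const 1 k) (*-identityʳ k)) ⟩
  ∑₁ (λ i → singleIn (T i) colℓ) k + k ∎

∑₁-singleIn-ℓc : ∀ (T : ℕ → PType) k →
  ∑₁ (λ i → singleIn (T i) colℓ) k + ∑₁ (λ i → singleIn (T i) colc) k ≡ ∑₁ (λ i → pairIn (T i) colℓ) k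
∑₁-singleIn-ℓc T k =
  trans (sym (∑₁-distrib (λ i → singleIn (T i) colℓ) (λ i → singleIn (T i) colc) k))
        (∑₁-cong k (λ i _ → singleIn-ℓc (T (suc i))))

ptype-pair : ∀ {n} (π : PF n) a i → i ≤ a →
  ptype π a i ≡ pairType (colOf (col π) (2 * i ∸ 1)) (colOf (col π) (2 * i))
ptype-pair π a i i≤a with i ≤? a
... | yes _   = refl
... | no  i≰a = ⊥-elim (i≰a i≤a)

ptype-single : ∀ {n} (π : PF n) a s → ptype π a (a + suc s) ≡ singleType (colOf (col π) (2 * a + suc s))
ptype-single π a s with a + suc s ≤? a
... | yes a+1+s≤a = ⊥-elim (m+1+n≰m a a+1+s≤a)
... | no _      = cong (singleType ∘ colOf (col π)) (a+[a+m]≡2a+m a (suc s))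
  where
  a+[a+m]≡2a+m : ∀ a m → a + (a + m) ≡ 2 * a + m
  a+[a+m]≡2a+m = solve-∀

-- Columns of the cars of 𝕊(π)

[2j+1+1]/2≡1+j : ∀ j → (suc (2 * j) + 1) / 2 ≡ suc j
[2j+1+1]/2≡1+j j = trans (cong (_/ 2) (2j+2≡[1+j]*2 j)) (m*n/n≡m (suc j) 2)
  where
  2j+2≡[1+j]*2 : ∀ j → suc (2 * j) + 1 ≡ suc j * 2
  2j+2≡[1+j]*2 = solve-∀

[2j+1]%2≡1 : ∀ j → suc (2 * j) % 2 ≡ 1
[2j+1]%2≡1 j = trans (cong (_% 2) (2j+1≡1+j*2 j)) ([m+kn]%n≡m%n 1 j 2)
  where
  2j+1≡1+j*2 : ∀ j → suc (2 * j) ≡ 1 + j * 2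
  2j+1≡1+j*2 = solve-∀

[2j+2+1]/2≡1+j : ∀ j → (suc (suc (2 * j)) + 1) / 2 ≡ suc j
[2j+2+1]/2≡1+j j = begin
  (suc (suc (2 * j)) + 1) / 2   ≡⟨ cong (_/ 2) (2j+3≡[1+j]*2+1 j) ⟩
  (suc j * 2 + 1) / 2           ≡⟨ +-distrib-/-∣ˡ 1 {2} (n∣m*n (suc j)) ⟩
  suc j * 2 / 2 + 0             ≡⟨ +-identityʳ _ ⟩
  suc j * 2 / 2                 ≡⟨ m*n/n≡m (suc j) 2 ⟩
  suc j                         ∎
  where
  2j+3≡[1+j]*2+1 : ∀ j → suc (suc (2 * j)) + 1 ≡ suc j * 2 + 1
  2j+3≡[1+j]*2+1 = solve-∀

[2j+2]%2≡0 : ∀ j → suc (suc (2 * j)) % 2 ≡ 0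
[2j+2]%2≡0 j = trans (cong (_% 2) (2j+2≡[1+j]*2 j)) (m*n%n≡0 (suc j) 2)
  where
  2j+2≡[1+j]*2 : ∀ j → suc (suc (2 * j)) ≡ suc j * 2
  2j+2≡[1+j]*2 = solve-∀

2j+2≤2b : ∀ {j b} → j < b → suc (suc (2 * j)) ≤ 2 * b
2j+2≤2b {j} {b} j<b = subst (_≤ 2 * b) (*-suc 2 j) (*-monoʳ-≤ 2 j<b)

switchCol-odd : ∀ {n} (π : PF n) a b j → j < b →
  switchColℕ π a b (suc (2 * j)) ≡ proj₁ (pairCols (ptype π a (a + b + 1 ∸ suc j)))
switchCol-odd π a b j j<b with suc (2 * j) ≤? 2 * b
... | no  2j+1≰2b = ⊥-elim (2j+1≰2b (<⇒≤ (2j+2≤2b j<b)))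
... | yes _ rewrite [2j+1+1]/2≡1+j j | [2j+1]%2≡1 j = refl

switchCol-even : ∀ {n} (π : PF n) a b j → j < b →
  switchColℕ π a b (suc (suc (2 * j))) ≡ proj₂ (pairCols (ptype π a (a + b + 1 ∸ suc j)))
switchCol-even π a b j j<b with suc (suc (2 * j)) ≤? 2 * b
... | no  2j+2≰2b = ⊥-elim (2j+2≰2b (2j+2≤2b j<b))
... | yes _ rewrite [2j+2+1]/2≡1+j j | [2j+2]%2≡0 j = refl

switchCol-single : ∀ {n} (π : PF n) a b j →
  switchColℕ π a b (2 * b + suc j) ≡ singleCol (ptype π a (a ∸ j))
switchCol-single π a b j with 2 * b + suc j ≤? 2 * b
... | yes 2b+1+j≤2b = ⊥-elim (m+1+n≰m (2 * b) 2b+1+j≤2b)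
... | no _          = cong (singleCol ∘ ptype π a) object≡
  where
  object≡ : a + b + 1 ∸ (2 * b + suc j ∸ b) ≡ a ∸ j
  object≡ = begin
    a + b + 1 ∸ (2 * b + suc j ∸ b)   ≡⟨ cong₂ _∸_ (a+b+1≡b+[1+a] a b) (cong (_∸ b) (2b+m≡b+m+b b (suc j))) ⟩
    b + suc a ∸ (b + suc j + b ∸ b)   ≡⟨ cong (b + suc a ∸_) (m+n∸n≡m (b + suc j) b) ⟩
    b + suc a ∸ (b + suc j)           ≡⟨ [m+n]∸[m+o]≡n∸o b (suc a) (suc j) ⟩
    a ∸ j                             ∎
    where
    a+b+1≡b+[1+a] : ∀ a b → a + b + 1 ≡ b + suc a
    a+b+1≡b+[1+a] = solve-∀
    2b+m≡b+m+b : ∀ b m → 2 * b + m ≡ b + m + b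
    2b+m≡b+m+b = solve-∀

-- Column heights of π and 𝕊(π)

count-pairs-singles : ∀ {n} (π : PF n) a b → n ≡ 2 * a + b →
  (∀ i → i < a → colOf (col π) (2 * suc i ∸ 1) ≢ colOf (col π) (2 * suc i)) → ∀ x →
  count (col π) x ≡ ∑₁ (λ i → pairIn (ptype π a i) x) a + ∑₁ (λ s → singleIn (ptype π a (a + s)) x) b
count-pairs-singles {n} π a b n≡2a+b pairs-split x = begin
  count (col π) x                                               ≡⟨ count≡∑₁ (col π) x ⟩
  ∑₁ F n                                                        ≡⟨ cong (∑₁ F) n≡2a+b ⟩
  ∑₁ F (2 * a + b)                                              ≡⟨ ∑₁-+ F (2 * a) b ⟩
  ∑₁ F (2 * a) + ∑₁ (λ s → F (2 * a + s)) b                     ≡⟨ cong₂ _+_ (∑₁-pairs F a) refl ⟩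
  ∑₁ (λ i → F (2 * i ∸ 1) + F (2 * i)) a + ∑₁ (λ s → F (2 * a + s)) b
    ≡⟨ cong₂ _+_ (∑₁-cong a pair) (∑₁-cong b single) ⟩
  ∑₁ (λ i → pairIn (T i) x) a + ∑₁ (λ s → singleIn (T (a + s)) x) b ∎
  where
  T = ptype π a
  F = λ k → δ (colOf (col π) k) x
  pair : ∀ i → i < a → F (2 * suc i ∸ 1) + F (2 * suc i) ≡ pairIn (T (suc i)) x
  pair i i<a = trans (pairType-pairIn _ _ x (pairs-split i i<a))
                     (cong (λ t → pairIn t x) (sym (ptype-pair π a (suc i) i<a)))
  single : ∀ s → s < b → F (2 * a + suc s) ≡ singleIn (T (a + suc s)) x
  single s _ = trans (singleType-singleIn (colOf (col π) (2 * a + suc s)) x)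
                     (cong (λ t → singleIn t x) (sym (ptype-single π a s)))

count-switch-pairs-singles : ∀ {n} (π : PF n) a b x →
  count (switch π a b) x ≡ ∑₁ (λ s → pairIn (ptype π a (a + s)) x) b + ∑₁ (λ i → singleIn (ptype π a i) x) a
count-switch-pairs-singles π a b x = begin
  count (switch π a b) x                                        ≡⟨ count-switch≡∑₁ π a b x ⟩
  ∑₁ F (a + 2 * b)                                              ≡⟨ cong (∑₁ F) (+-comm a (2 * b)) ⟩
  ∑₁ F (2 * b + a)                                              ≡⟨ ∑₁-+ F (2 * b) a ⟩
  ∑₁ F (2 * b) + ∑₁ (λ j → F (2 * b + j)) a                     ≡⟨ cong₂ _+_ (∑₁-pairs F b) refl ⟩
  ∑₁ (λ j → F (2 * j ∸ 1) + F (2 * j)) b + ∑₁ (λ j → F (2 * b + j)) a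
    ≡⟨ cong₂ _+_ (∑₁-cong b pair) (∑₁-cong a single) ⟩
  ∑₁ (λ j → P (suc b ∸ j)) b + ∑₁ (λ j → S (suc a ∸ j)) a       ≡⟨ cong₂ _+_ (∑₁-reverse P b) (∑₁-reverse S a) ⟩
  ∑₁ P b + ∑₁ S a                                               ∎
  where
  T = ptype π a
  F = λ k → δ (switchColℕ π a b k) x
  P = λ s → pairIn (T (a + s)) x
  S = λ i → singleIn (T i) x
  pair : ∀ j → j < b → F (2 * suc j ∸ 1) + F (2 * suc j) ≡ P (suc b ∸ suc j)
  pair j j<b = begin
    F (2 * suc j ∸ 1) + F (2 * suc j)          ≡⟨ cong₂ _+_ (cong F (2[1+j]∸1≡2j+1 j)) (cong F (*-suc 2 j)) ⟩
    F (suc (2 * j)) + F (suc (suc (2 * j)))    ≡⟨ cong₂ _+_ (cong (λ u → δ u x) (switchCol-odd π a b j j<b))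
                                                            (cong (λ u → δ u x) (switchCol-even π a b j j<b)) ⟩
    pairIn (T (a + b + 1 ∸ suc j)) x           ≡⟨ cong (λ i → pairIn (T i) x) object≡ ⟩
    P (suc b ∸ suc j)                          ∎
    where
    a+b+1≡a+[1+b] : ∀ a b → a + b + 1 ≡ a + suc b
    a+b+1≡a+[1+b] = solve-∀
    object≡ : a + b + 1 ∸ suc j ≡ a + (suc b ∸ suc j)
    object≡ = trans (cong (_∸ suc j) (a+b+1≡a+[1+b] a b)) (+-∸-assoc a (s≤s (<⇒≤ j<b)))
  single : ∀ j → j < a → F (2 * b + suc j) ≡ S (suc a ∸ suc j)
  single j _ = cong (λ u → δ u x) (switchCol-single π a b j)

switch-heights : ∀ {n} (π : PF n) a b → pides π ≡ twoOne a b →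
  (count (col π) colℓ + count (col π) colc ≡ count (switch π a b) colℓ + a) ×
  (count (switch π a b) colℓ + count (switch π a b) colc ≡ count (col π) colℓ + b)
switch-heights π a b pides≡ = ℓc-π , ℓc-𝕊
  where
  T = ptype π a
  T⁺ = λ s → T (a + s)
  P Q P' Q' : Fin 3 → ℕ
  P  x = ∑₁ (λ i → pairIn (T i) x) a
  Q  x = ∑₁ (λ s → singleIn (T⁺ s) x) b
  P' x = ∑₁ (λ i → singleIn (T i) x) a
  Q' x = ∑₁ (λ s → pairIn (T⁺ s) x) b
  hπ : ∀ x → count (col π) x ≡ P x + Q x
  hπ = count-pairs-singles π a b (pides-twoOne⇒size π a b pides≡) (pides-twoOne⇒pairs-split π a b pides≡)
  h𝕊 : ∀ x → count (switch π a b) x ≡ Q' x + P' x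
  h𝕊 = count-switch-pairs-singles π a b
  rotate : ∀ p q r → p + q + r ≡ r + p + q
  rotate = solve-∀
  ℓc-π : count (col π) colℓ + count (col π) colc ≡ count (switch π a b) colℓ + a
  ℓc-π = begin
    count (col π) colℓ + count (col π) colc  ≡⟨ cong₂ _+_ (hπ colℓ) (hπ colc) ⟩
    P colℓ + Q colℓ + (P colc + Q colc)      ≡⟨ interchange (P colℓ) (Q colℓ) (P colc) (Q colc) ⟩
    P colℓ + P colc + (Q colℓ + Q colc)      ≡⟨ cong₂ _+_ (∑₁-pairIn-ℓc T a) (∑₁-singleIn-ℓc T⁺ b) ⟩
    P' colℓ + a + Q' colℓ                    ≡⟨ rotate (P' colℓ) a (Q' colℓ) ⟩
    Q' colℓ + P' colℓ + a                    ≡⟨ cong (_+ a) (h𝕊 colℓ) ⟨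
    count (switch π a b) colℓ + a            ∎
  ℓc-𝕊 : count (switch π a b) colℓ + count (switch π a b) colc ≡ count (col π) colℓ + b
  ℓc-𝕊 = begin
    count (switch π a b) colℓ + count (switch π a b) colc ≡⟨ cong₂ _+_ (h𝕊 colℓ) (h𝕊 colc) ⟩
    Q' colℓ + P' colℓ + (Q' colc + P' colc)  ≡⟨ interchange (Q' colℓ) (P' colℓ) (Q' colc) (P' colc) ⟩
    Q' colℓ + Q' colc + (P' colℓ + P' colc)  ≡⟨ cong₂ _+_ (∑₁-pairIn-ℓc T⁺ b) (∑₁-singleIn-ℓc T a) ⟩
    Q colℓ + b + P colℓ                      ≡⟨ rotate (Q colℓ) b (P colℓ) ⟩
    P colℓ + Q colℓ + b                      ≡⟨ cong (_+ b) (hπ colℓ) ⟨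
    count (col π) colℓ + b                   ∎

switch-bounds : ∀ a b h₁ h₂ h₁' h₂' → 2 * a + b ≤ 3 * h₁ → 2 * (2 * a + b) ≤ 3 * h₂ →
  h₂ ≡ h₁' + a → h₂' ≡ h₁ + b → (a + 2 * b ≤ 3 * h₁') × (2 * (a + 2 * b) ≤ 3 * h₂')
switch-bounds a b h₁ h₂ h₁' h₂' h₁-bound h₂-bound refl refl =
  +-cancelˡ-≤ (3 * a) _ _ (subst₂ _≤_ (lhs₁ a b) (rhs₁ h₁' a) h₂-bound) ,
  subst₂ _≤_ (lhs₂ a b) (rhs₂ h₁ b) (+-monoˡ-≤ (3 * b) h₁-bound)
  where
  lhs₁ : ∀ a b → 2 * (2 * a + b) ≡ 3 * a + (a + 2 * b)
  lhs₁ = solve-∀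
  rhs₁ : ∀ h a → 3 * (h + a) ≡ 3 * a + 3 * h
  rhs₁ = solve-∀
  lhs₂ : ∀ a b → 2 * a + b + 3 * b ≡ 2 * (a + 2 * b)
  lhs₂ = solve-∀
  rhs₂ : ∀ h b → 3 * h + 3 * b ≡ 3 * (h + b)
  rhs₂ = solve-∀

theorem11 : (n : ℕ) → 0 < n → (π : PF n) → (a b : ℕ) →
    pides π ≡ twoOne a b → IsPF (a + 2 * b) (switch π a b)
theorem11 n _ π a b pides≡ =
  switch-bounds a b _ _ _ _
    (subst (_≤ 3 * count (col π) colℓ) size (proj₁ (isPF π)))
    (subst (λ m → 2 * m ≤ 3 * (count (col π) colℓ + count (col π) colc)) size (proj₂ (isPF π)))
    (proj₁ heights) (proj₂ heights)
  where
  size = pides-twoOne⇒size π a b pides≡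
  heights = switch-heights π a b pides≡
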